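{- Let $G$ be a tree of order $n \ge 5$. If $Z(G)=n-3$, then $G$ is the graph obtained from the star $S_{n-1}=K_{1,n-2}$ by subdividing one of its edges once (i.e., replacing one edge $vx$ by a path $v,s,x$ through a new vertex $s$).
   Context: For a finite simple graph $G$, color a set $S\subseteq V(G)$ black and all other vertices white. The color-change rule: if a black vertex $u$ has exactly one white neighbor $w$, then $w$ is turned black. $S$ is a zero forcing set if repeated application of the rule eventually turns all vertices black; $Z(G)$ is the minimum size of a zero forcing set. $S_{n-1}=K_{1,n-2}$ is the star on $n-1$ vertices. -}

module Defs where

open import Data.Nat using (ℕ; zero; suc; _≤_; _∸_)
open import Data.Bool using (Bool; true; false)
open import Data.Fin using (Fin; toℕ)
open import Data.Fin.Subset using (Subset; _∈_; ∣_∣)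
open import Data.List using (List; []; _∷_; _++_)
open import Data.List.Relation.Unary.Unique.Propositional using (Unique)
open import Data.List.Relation.Unary.Linked using (Linked)
open import Data.Product using (Σ; _×_; ∃; ∃-syntax)
open import Function.Bundles using (_↔_; Inverse)
open import Relation.Binary.PropositionalEquality using (_≡_; _≢_; refl)
open import Relation.Nullary using (¬_)

record Graph (n : ℕ) : Set where
  field
    adj    : Fin n → Fin n → Bool
    sym    : ∀ u v → adj u v ≡ adj v u
    irrefl : ∀ u → adj u u ≡ false

open Graph public

Adj : ∀ {n} → Graph n → Fin n → Fin n → Set
Adj G u v = adj G u v ≡ true

data Reach {n} (G : Graph n) : Fin n → Fin n → Set where
  here : ∀ {u} → Reach G u u
  step : ∀ {u v w} → Adj G u v → Reach G v w → Reach G u w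

Connected : ∀ {n} → Graph n → Set
Connected G = ∀ u v → Reach G u v

HasCycle : ∀ {n} → Graph n → Set
HasCycle {n} G =
  Σ (Fin n) λ v0 → Σ (Fin n) λ v1 → Σ (Fin n) λ v2 → Σ (List (Fin n)) λ rest →
    Unique (v0 ∷ v1 ∷ v2 ∷ rest) × Linked (Adj G) (v0 ∷ v1 ∷ v2 ∷ rest ++ v0 ∷ [])

IsTree : ∀ {n} → Graph n → Set
IsTree G = Connected G × ¬ HasCycle G

-- Derived (final) black set from initial black set S:
-- a black vertex u forces its neighbour w whenever every other neighbour
-- of u is black (i.e. w is its only possibly-white neighbour).
data Black {n} (G : Graph n) (S : Subset n) : Fin n → Set where
  init  : ∀ {v} → v ∈ S → Black G S v
  force : ∀ {u w} → Black G S u → Adj G u w →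
          (∀ x → Adj G u x → x ≢ w → Black G S x) → Black G S w

IsZeroForcingSet : ∀ {n} → Graph n → Subset n → Set
IsZeroForcingSet G S = ∀ v → Black G S v

ZeroForcingNumber : ∀ {n} → Graph n → ℕ → Set
ZeroForcingNumber {n} G k =
  (Σ (Subset n) λ S → IsZeroForcingSet G S × ∣ S ∣ ≡ k) ×
  (∀ S → IsZeroForcingSet G S → k ≤ ∣ S ∣)

_≅_ : ∀ {n} → Graph n → Graph n → Set
_≅_ {n} G H = Σ (Fin n ↔ Fin n) λ f →
  ∀ u v → adj H (Inverse.to f u) (Inverse.to f v) ≡ adj G u v

-- Vertices (as naturals): 0 = centre, 1 = subdivision vertex s,
-- 2 = the leaf x at the end of the subdivided edge, 3..n-1 = other leaves.
private
  e : ℕ → ℕ → Bool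
  e 0 1 = true
  e 1 2 = true
  e 0 (suc (suc (suc _))) = true
  e _ _ = false

  sadj : ℕ → ℕ → Bool
  sadj a b = Data.Bool._∨_ (e a b) (e b a)

  open import Data.Bool.Properties using (∨-comm)

  sadj-sym : ∀ a b → sadj a b ≡ sadj b a
  sadj-sym a b = ∨-comm (e a b) (e b a)

  sadj-irr : ∀ a → sadj a a ≡ false
  sadj-irr 0 = refl
  sadj-irr 1 = refl
  sadj-irr (suc (suc k)) = refl

SubdividedStar : (n : ℕ) → Graph n
SubdividedStar n = record
  { adj    = λ u v → sadj (toℕ u) (toℕ v)
  ; sym    = λ u v → sadj-sym (toℕ u) (toℕ v)
  ; irrefl = λ u → sadj-irr (toℕ u)
  }

-- Z(T) ≥ n − 3 means that no four vertices can be deleted leaving a zero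
-- forcing set.  In a tree this excludes a path on five vertices (all but one end
-- of it may be deleted: the path forces itself from that end) and two adjacent
-- vertices with two further neighbours each (delete both centres and one further
-- neighbour of each: the remaining neighbours force the centres, which then
-- force the deleted ones).  A tree without a path on four vertices is a star,
-- where two white leaves are twins and are never forced, so Z = n − 2.
-- Otherwise a path a – b – c – d can be chosen with c of degree two, and with no
-- path on five vertices d is a leaf and every other vertex is a leaf at b.
module Submission where

open import Defs hiding (sym)
open import Data.Nat using (ℕ; suc; _+_; _≤_; _<_; _∸_; s≤s)
open import Data.Nat.Properties using (m≤n⇒m≤1+n; <⇒≱; 1+n≰n; ∸-monoˡ-≤; module ≤-Reasoning)
open import Data.Bool using (true; false)
open import Data.Bool.Properties using (¬-not)
import Data.Bool as Bool
open import Data.Fin using (Fin; zero; suc; _≟_)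
open import Data.Fin.Patterns using (0F; 1F; 2F)
open import Data.Fin.Properties using (any?)
open import Data.Fin.Subset using (Subset; _∈_; _∉_; ∣_∣; ⊤; _-_; _─_; _⊆_; inside; outside)
import Data.Fin.Subset as Subset
open import Data.Fin.Subset.Properties
  using (∈⊤; ∉⊥; _∈?_; ∣⊤∣≡n; p⊆q⇒∣p∣≤∣q∣; x∈p⇒∣p-x∣<∣p∣; x∈p∧x≢y⇒x∈p-y; x∈p∧x∉q⇒x∈p─q; p─q⊆p)
open import Data.Fin.Permutation using (Permutation; _∘ₚ_; _⟨$⟩ʳ_)
import Data.Fin.Permutation as Permutation
import Data.Fin.Permutation.Components as PC
open import Data.List using ([]; _∷_)
open import Data.List.Relation.Unary.All using ([]; _∷_)
open import Data.List.Relation.Unary.AllPairs using ([]; _∷_)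
open import Data.List.Relation.Unary.Linked using ([-]; _∷_)
open import Data.Vec using (_∷_)
open import Data.Vec.Base using (there)
open import Data.Product using (Σ; ∃; _×_; _,_; proj₁; proj₂)
open import Data.Sum using (_⊎_; inj₁; inj₂)
open import Data.Empty using (⊥; ⊥-elim)
open import Function using (_∘_)
open import Function.Bundles using (Injection)
open import Function.Properties.Inverse using (↔⇒↣)
open import Relation.Binary.PropositionalEquality using (_≡_; _≢_; refl; sym; trans; cong; subst; ≢-sym)
open import Relation.Nullary using (¬_; Dec; yes; no; ¬?)
open import Relation.Nullary.Decidable using (_×-dec_; _⊎-dec_; dec-true; dec-false; decidable-stable)

x∉p-x : ∀ {n} (p : Subset n) x → x ∉ p - x
x∉p-x (_ ∷ p) zero    ()
x∉p-x (_ ∷ p) (suc x) (there x∈p-x) = x∉p-x p x x∈p-x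

x∈p-y⇒x≢y : ∀ {n} {p : Subset n} {x y} → x ∈ p - y → x ≢ y
x∈p-y⇒x≢y {p = p} x∈p-x refl = x∉p-x p _ x∈p-x

∣p∣≤∣p─⊥∣ : ∀ {n} (p : Subset n) → ∣ p ∣ ≤ ∣ p ─ Subset.⊥ ∣
∣p∣≤∣p─⊥∣ p = p⊆q⇒∣p∣≤∣q∣ {p = p} {q = p ─ Subset.⊥} (λ x∈p → x∈p∧x∉q⇒x∈p─q x∈p ∉⊥)

∣p∣≤1+∣p-x∣ : ∀ {n} (p : Subset n) x → ∣ p ∣ ≤ suc ∣ p - x ∣
∣p∣≤1+∣p-x∣ (inside  ∷ p) zero    = s≤s (∣p∣≤∣p─⊥∣ p)
∣p∣≤1+∣p-x∣ (outside ∷ p) zero    = m≤n⇒m≤1+n (∣p∣≤∣p─⊥∣ p)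
∣p∣≤1+∣p-x∣ (inside  ∷ p) (suc x) = s≤s (∣p∣≤1+∣p-x∣ p x)
∣p∣≤1+∣p-x∣ (outside ∷ p) (suc x) = ∣p∣≤1+∣p-x∣ p x

module _ {n : ℕ} where

  allBut₄ : Fin n → Fin n → Fin n → Fin n → Subset n
  allBut₄ a b c d = ⊤ - a - b - c - d

  ∈allBut₄ : ∀ {a b c d x} → x ≢ a → x ≢ b → x ≢ c → x ≢ d → x ∈ allBut₄ a b c d
  ∈allBut₄ x≢a x≢b x≢c x≢d =
    x∈p∧x≢y⇒x∈p-y (x∈p∧x≢y⇒x∈p-y (x∈p∧x≢y⇒x∈p-y (x∈p∧x≢y⇒x∈p-y ∈⊤ x≢a) x≢b) x≢c) x≢d

  allBut₄-elim : ∀ {a b c d} {ℓ} {P : Set ℓ} x →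
                 (x ≡ a → P) → (x ≡ b → P) → (x ≡ c → P) → (x ≡ d → P) → (x ∈ allBut₄ a b c d → P) → P
  allBut₄-elim {a} {b} {c} {d} x at-a at-b at-c at-d elsewhere with x ≟ a | x ≟ b | x ≟ c | x ≟ d
  ... | yes x≡a | _       | _       | _       = at-a x≡a
  ... | no _    | yes x≡b | _       | _       = at-b x≡b
  ... | no _    | no _    | yes x≡c | _       = at-c x≡c
  ... | no _    | no _    | no _    | yes x≡d = at-d x≡d
  ... | no x≢a  | no x≢b  | no x≢c  | no x≢d  = elsewhere (∈allBut₄ x≢a x≢b x≢c x≢d)

  ∣allBut₄∣<n∸3 : ∀ {a b c d} → a ≢ b → a ≢ c → a ≢ d → b ≢ c → b ≢ d → c ≢ d →
                  ∣ allBut₄ a b c d ∣ < n ∸ 3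
  ∣allBut₄∣<n∸3 {a} {b} {c} {d} a≢b a≢c a≢d b≢c b≢d c≢d = ∸-monoˡ-≤ 3 (begin
    4 + ∣ ⊤ - a - b - c - d ∣ ≤⟨ s≤s (s≤s (s≤s (shrink (⊤ - a - b - c) (∈⊤ ∖ a≢d ∖ b≢d ∖ c≢d)))) ⟩
    3 + ∣ ⊤ - a - b - c ∣     ≤⟨ s≤s (s≤s (shrink (⊤ - a - b) (∈⊤ ∖ a≢c ∖ b≢c))) ⟩
    2 + ∣ ⊤ - a - b ∣         ≤⟨ s≤s (shrink (⊤ - a) (∈⊤ ∖ a≢b)) ⟩
    1 + ∣ ⊤ - a ∣             ≤⟨ shrink ⊤ ∈⊤ ⟩
    ∣ ⊤ {n} ∣                 ≡⟨ ∣⊤∣≡n n ⟩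
    n                         ∎)
    where
    open ≤-Reasoning
    infixl 5 _∖_
    _∖_ : ∀ {p : Subset n} {x y} → x ∈ p → y ≢ x → x ∈ p - y
    x∈p ∖ y≢x = x∈p∧x≢y⇒x∈p-y x∈p (≢-sym y≢x)
    shrink : ∀ (p : Subset n) {x} → x ∈ p → suc ∣ p - x ∣ ≤ ∣ p ∣
    shrink p = x∈p⇒∣p-x∣<∣p∣ {p = p}

module Adjacency {n : ℕ} (G : Graph n) where

  Adj? : ∀ x y → Dec (Adj G x y)
  Adj? x y = adj G x y Bool.≟ true

  Adj-irrefl : ∀ {x} → ¬ Adj G x x
  Adj-irrefl {x} xx with trans (sym (irrefl G x)) xx
  ... | ()

  Adj⇒≢ : ∀ {x y} → Adj G x y → x ≢ y
  Adj⇒≢ xx refl = Adj-irrefl xx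

  Adj-sym : ∀ {x y} → Adj G x y → Adj G y x
  Adj-sym {x} {y} = trans (Graph.sym G y x)

  Adj∧¬Adj⇒≢ : ∀ {u x y} → Adj G u x → ¬ Adj G u y → x ≢ y
  Adj∧¬Adj⇒≢ ux ¬uy refl = ¬uy ux

  ¬Adj⇒adj≡false : ∀ {x y} → ¬ Adj G x y → adj G x y ≡ false
  ¬Adj⇒adj≡false = ¬-not

  LeafOf : Fin n → Fin n → Set
  LeafOf v u = ∀ {z} → Adj G v z → z ≡ u

  otherNeighbour? : ∀ x y → (∃ λ w → Adj G x w × w ≢ y) ⊎ LeafOf x y
  otherNeighbour? x y with any? (λ w → Adj? x w ×-dec ¬? (w ≟ y))
  ... | yes found = inj₁ found
  ... | no none   = inj₂ λ {w} xw → decidable-stable (w ≟ y) λ w≢y → none (w , xw , w≢y)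

  thirdNeighbour? : ∀ x y z →
    (∃ λ w → Adj G x w × w ≢ y × w ≢ z) ⊎ (∀ {w} → Adj G x w → w ≡ y ⊎ w ≡ z)
  thirdNeighbour? x y z with any? (λ w → Adj? x w ×-dec (¬? (w ≟ y) ×-dec ¬? (w ≟ z)))
  ... | yes found = inj₁ found
  ... | no none   = inj₂ λ {w} xw → decidable-stable ((w ≟ y) ⊎-dec (w ≟ z))
                      λ ¬w∈yz → none (w , xw , ¬w∈yz ∘ inj₁ , ¬w∈yz ∘ inj₂)

  neighbour : Connected G → ∀ {u v} → u ≢ v → ∃ λ w → Adj G u w
  neighbour connected {u} {v} u≢v with connected u v
  ... | here      = ⊥-elim (u≢v refl)
  ... | step uw _ = _ , uw

  closed⇒everywhere : Connected G → ∀ {ℓ} (P : Fin n → Set ℓ) → (∀ {x y} → P x → Adj G y x → P y) →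
                      ∀ {r} → P r → ∀ v → P v
  closed⇒everywhere connected P closed {r} Pr v = along (connected v r)
    where
    along : ∀ {u} → Reach G u r → P u
    along here           = Pr
    along (step uw walk) = closed (along walk) uw

-- Non-backtracking walks; in an acyclic graph their vertices are distinct.
Path₄ : ∀ {n} → Graph n → (a b c d : Fin n) → Set
Path₄ G a b c d = Adj G a b × Adj G b c × Adj G c d × a ≢ c × b ≢ d

Path₄-reverse : ∀ {n} {G : Graph n} {a b c d} → Path₄ G a b c d → Path₄ G d c b a
Path₄-reverse {G = G} (ab , bc , cd , a≢c , b≢d) = Adj-sym cd , Adj-sym bc , Adj-sym ab , ≢-sym b≢d , ≢-sym a≢c
  where open Adjacency G

Path₅ : ∀ {n} → Graph n → (v₀ v₁ v₂ v₃ v₄ : Fin n) → Set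
Path₅ G v₀ v₁ v₂ v₃ v₄ =
  Adj G v₀ v₁ × Adj G v₁ v₂ × Adj G v₂ v₃ × Adj G v₃ v₄ × v₀ ≢ v₂ × v₁ ≢ v₃ × v₂ ≢ v₄

Path₄? : ∀ {n} (G : Graph n) → Dec (∃ λ a → ∃ λ b → ∃ λ c → ∃ λ d → Path₄ G a b c d)
Path₄? G = any? λ a → any? λ b → any? λ c → any? λ d →
  Adj? a b ×-dec Adj? b c ×-dec Adj? c d ×-dec ¬? (a ≟ c) ×-dec ¬? (b ≟ d)
  where open Adjacency G

module Acyclic {n : ℕ} {G : Graph n} (acyclic : ¬ HasCycle G) where
  open Adjacency G

  ¬triangle : ∀ {x y z} → Adj G x y → Adj G y z → Adj G z x → ⊥
  ¬triangle {x} {y} {z} xy yz zx = acyclic (x , y , z , [] ,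
    ((Adj⇒≢ xy ∷ ≢-sym (Adj⇒≢ zx) ∷ []) ∷ (Adj⇒≢ yz ∷ []) ∷ [] ∷ []) ,
    (xy ∷ yz ∷ zx ∷ [-]))

  ¬square : ∀ {x y z w} → Adj G x y → Adj G y z → Adj G z w → Adj G w x → x ≢ z → y ≢ w → ⊥
  ¬square {x} {y} {z} {w} xy yz zw wx x≢z y≢w = acyclic (x , y , z , w ∷ [] ,
    ((Adj⇒≢ xy ∷ x≢z ∷ ≢-sym (Adj⇒≢ wx) ∷ []) ∷ (Adj⇒≢ yz ∷ y≢w ∷ []) ∷ (Adj⇒≢ zw ∷ []) ∷ [] ∷ []) ,
    (xy ∷ yz ∷ zw ∷ wx ∷ [-]))

  ¬pentagon : ∀ {x y z w v} → Adj G x y → Adj G y z → Adj G z w → Adj G w v → Adj G v x →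
              x ≢ z → x ≢ w → y ≢ w → y ≢ v → z ≢ v → ⊥
  ¬pentagon {x} {y} {z} {w} {v} xy yz zw wv vx x≢z x≢w y≢w y≢v z≢v = acyclic (x , y , z , w ∷ v ∷ [] ,
    ((Adj⇒≢ xy ∷ x≢z ∷ x≢w ∷ ≢-sym (Adj⇒≢ vx) ∷ []) ∷ (Adj⇒≢ yz ∷ y≢w ∷ y≢v ∷ []) ∷
      (Adj⇒≢ zw ∷ z≢v ∷ []) ∷ (Adj⇒≢ wv ∷ []) ∷ [] ∷ []) ,
    (xy ∷ yz ∷ zw ∷ wv ∷ vx ∷ [-]))

-- A vertex adjacent to one white twin always has the other as a second white neighbour.
twins-stay-white : ∀ {n} {G : Graph n} {S w₁ w₂} → w₁ ≢ w₂ → w₁ ∉ S → w₂ ∉ S →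
  (∀ {z} → Adj G z w₁ → Adj G z w₂) → (∀ {z} → Adj G z w₂ → Adj G z w₁) →
  ∀ {v} → Black G S v → v ≢ w₁ × v ≢ w₂
twins-stay-white {G = G} {S} {w₁} {w₂} w₁≢w₂ w₁∉S w₂∉S twin₁₂ twin₂₁ = white
  where
  white : ∀ {v} → Black G S v → v ≢ w₁ × v ≢ w₂
  white (init v∈S)           = (λ { refl → w₁∉S v∈S }) , (λ { refl → w₂∉S v∈S })
  white (force _ uw othersB) =
    (λ { refl → proj₂ (white (othersB _ (twin₁₂ uw) (≢-sym w₁≢w₂))) refl }) ,
    (λ { refl → proj₁ (white (othersB _ (twin₂₁ uw) w₁≢w₂)) refl })

module Star {n : ℕ} (G : Graph n) {u : Fin n}
  (centre : ∀ {w} → w ≢ u → Adj G w u)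
  (leaf : ∀ {w} → w ≢ u → Adjacency.LeafOf G w u) where
  open Adjacency G

  twins : ∀ {w₁ w₂ z} → w₁ ≢ u → w₂ ≢ u → Adj G z w₁ → Adj G z w₂
  twins w₁≢u w₂≢u zw₁ with leaf w₁≢u (Adj-sym zw₁)
  ... | refl = Adj-sym (centre w₂≢u)

  forcing-misses-at-most-one : ∀ {S} → IsZeroForcingSet G S → ∃ λ w → ⊤ - u - w ⊆ S
  forcing-misses-at-most-one {S} forces with any? (λ w → ¬? (w ∈? S) ×-dec ¬? (w ≟ u))
  ... | no none = u , λ {x} x∈ → decidable-stable (x ∈? S) λ x∉S →
        none (x , x∉S , x∈p-y⇒x≢y (p─q⊆p _ _ x∈))
  ... | yes (w , w∉S , w≢u) = w , λ {x} x∈ → decidable-stable (x ∈? S) λ x∉S →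
        let x≢u = x∈p-y⇒x≢y (p─q⊆p _ _ x∈) in
        proj₁ (twins-stay-white (x∈p-y⇒x≢y x∈) x∉S w∉S (twins x≢u w≢u) (twins w≢u x≢u) (forces x)) refl

  n≤2+∣S∣ : ∀ S → IsZeroForcingSet G S → n ≤ 2 + ∣ S ∣
  n≤2+∣S∣ S forces with forcing-misses-at-most-one forces
  ... | w , ⊤-u-w⊆S = begin
    n                 ≡⟨ sym (∣⊤∣≡n n) ⟩
    ∣ ⊤ {n} ∣         ≤⟨ ∣p∣≤1+∣p-x∣ ⊤ u ⟩
    1 + ∣ ⊤ - u ∣     ≤⟨ s≤s (∣p∣≤1+∣p-x∣ (⊤ - u) w) ⟩
    2 + ∣ ⊤ - u - w ∣ ≤⟨ s≤s (s≤s (p⊆q⇒∣p∣≤∣q∣ ⊤-u-w⊆S)) ⟩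
    2 + ∣ S ∣         ∎
    where open ≤-Reasoning

module Path₄Free {n : ℕ} (G : Graph n) (connected : Connected G)
  (¬path₄ : ∀ {a b c d} → ¬ Path₄ G a b c d) where
  open Adjacency G

  leaf-or-leaf : ∀ {u v} → Adj G u v → LeafOf v u ⊎ LeafOf u v
  leaf-or-leaf {u} {v} uv with otherNeighbour? v u
  ... | inj₂ v-leaf            = inj₁ v-leaf
  ... | inj₁ (z , vz , z≢u) = inj₂ λ {y} uy → decidable-stable (y ≟ v) λ y≢v →
        ¬path₄ (Adj-sym uy , uv , vz , y≢v , ≢-sym z≢u)

  module _ {u v} (uv : Adj G u v) (v-leaf : LeafOf v u) where

    two-steps-from-u : ∀ {x y} → Adj G x u → Adj G y x → y ≡ u
    two-steps-from-u {x} {y} xu yx with y ≟ u | x ≟ v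
    ... | yes y≡u | _        = y≡u
    ... | no _    | yes refl = v-leaf (Adj-sym yx)
    ... | no y≢u  | no x≢v   = ⊥-elim (¬path₄ (yx , xu , uv , y≢u , x≢v))

    centre : ∀ {w} → w ≢ u → Adj G w u
    centre {w} w≢u with closed⇒everywhere connected (λ x → x ≡ u ⊎ Adj G x u) closed (inj₁ refl) w
      where
      closed : ∀ {x y} → x ≡ u ⊎ Adj G x u → Adj G y x → y ≡ u ⊎ Adj G y u
      closed (inj₁ refl) yu = inj₂ yu
      closed (inj₂ xu)   yx = inj₁ (two-steps-from-u xu yx)
    ... | inj₁ w≡u = ⊥-elim (w≢u w≡u)
    ... | inj₂ wu  = wu

    star-bound : ∀ S → IsZeroForcingSet G S → n ≤ 2 + ∣ S ∣
    star-bound = Star.n≤2+∣S∣ G centre λ w≢u wz → two-steps-from-u (centre w≢u) (Adj-sym wz)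

  n≤2+Z : ∀ {u v : Fin n} → u ≢ v → ∀ S → IsZeroForcingSet G S → n ≤ 2 + ∣ S ∣
  n≤2+Z u≢v with neighbour connected u≢v
  ... | _ , uv with leaf-or-leaf uv
  ...   | inj₁ v-leaf = star-bound uv v-leaf
  ...   | inj₂ u-leaf = star-bound (Adj-sym uv) u-leaf

module LargeForcingNumber {n : ℕ} {G : Graph n} (acyclic : ¬ HasCycle G)
  (minimal : ∀ S → IsZeroForcingSet G S → n ∸ 3 ≤ ∣ S ∣) where
  open Adjacency G
  open Acyclic {G = G} acyclic

  ¬forcing-allBut₄ : ∀ {a b c d} → a ≢ b → a ≢ c → a ≢ d → b ≢ c → b ≢ d → c ≢ d →
                     ¬ IsZeroForcingSet G (allBut₄ a b c d)
  ¬forcing-allBut₄ a≢b a≢c a≢d b≢c b≢d c≢d forces =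
    <⇒≱ (∣allBut₄∣<n∸3 a≢b a≢c a≢d b≢c b≢d c≢d) (minimal _ forces)

  ¬path₅ : ∀ {v₀ v₁ v₂ v₃ v₄} → ¬ Path₅ G v₀ v₁ v₂ v₃ v₄
  ¬path₅ {v₀} {v₁} {v₂} {v₃} {v₄} (a₀₁ , a₁₂ , a₂₃ , a₃₄ , v₀≢v₂ , v₁≢v₃ , v₂≢v₄) =
    ¬forcing-allBut₄ (Adj⇒≢ a₁₂) v₁≢v₃ v₁≢v₄ (Adj⇒≢ a₂₃) v₂≢v₄ (Adj⇒≢ a₃₄) forces
    where
    v₀≢v₃ : v₀ ≢ v₃
    v₀≢v₃ refl = ¬triangle a₀₁ a₁₂ a₂₃
    v₁≢v₄ : v₁ ≢ v₄
    v₁≢v₄ refl = ¬triangle a₁₂ a₂₃ a₃₄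
    v₀≢v₄ : v₀ ≢ v₄
    v₀≢v₄ refl = ¬square a₀₁ a₁₂ a₂₃ a₃₄ v₀≢v₂ v₁≢v₃
    ¬a₀₂ : ¬ Adj G v₀ v₂
    ¬a₀₂ a₀₂ = ¬triangle a₀₁ a₁₂ (Adj-sym a₀₂)
    ¬a₀₃ : ¬ Adj G v₀ v₃
    ¬a₀₃ a₀₃ = ¬square a₀₁ a₁₂ a₂₃ (Adj-sym a₀₃) v₀≢v₂ v₁≢v₃
    ¬a₀₄ : ¬ Adj G v₀ v₄
    ¬a₀₄ a₀₄ = ¬pentagon a₀₁ a₁₂ a₂₃ a₃₄ (Adj-sym a₀₄) v₀≢v₂ v₀≢v₃ v₁≢v₃ v₁≢v₄ v₂≢v₄
    ¬a₁₃ : ¬ Adj G v₁ v₃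
    ¬a₁₃ a₁₃ = ¬triangle a₁₂ a₂₃ (Adj-sym a₁₃)
    ¬a₁₄ : ¬ Adj G v₁ v₄
    ¬a₁₄ a₁₄ = ¬square a₁₂ a₂₃ a₃₄ (Adj-sym a₁₄) v₁≢v₃ v₂≢v₄
    ¬a₂₄ : ¬ Adj G v₂ v₄
    ¬a₂₄ a₂₄ = ¬triangle a₂₃ a₃₄ (Adj-sym a₂₄)

    B : Fin n → Set
    B = Black G (allBut₄ v₁ v₂ v₃ v₄)
    black₀ : B v₀
    black₀ = init (∈allBut₄ (Adj⇒≢ a₀₁) v₀≢v₂ v₀≢v₃ v₀≢v₄)
    black₁ : B v₁
    black₁ = force black₀ a₀₁ λ x a₀ₓ x≢v₁ → allBut₄-elim x
      (⊥-elim ∘ x≢v₁)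
      (⊥-elim ∘ Adj∧¬Adj⇒≢ a₀ₓ ¬a₀₂)
      (⊥-elim ∘ Adj∧¬Adj⇒≢ a₀ₓ ¬a₀₃)
      (⊥-elim ∘ Adj∧¬Adj⇒≢ a₀ₓ ¬a₀₄)
      init
    black₂ : B v₂
    black₂ = force black₁ a₁₂ λ x a₁ₓ x≢v₂ → allBut₄-elim x
      (⊥-elim ∘ Adj⇒≢ a₁ₓ ∘ sym)
      (⊥-elim ∘ x≢v₂)
      (⊥-elim ∘ Adj∧¬Adj⇒≢ a₁ₓ ¬a₁₃)
      (⊥-elim ∘ Adj∧¬Adj⇒≢ a₁ₓ ¬a₁₄)
      init
    black₃ : B v₃
    black₃ = force black₂ a₂₃ λ x a₂ₓ x≢v₃ → allBut₄-elim x
      (λ { refl → black₁ })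
      (⊥-elim ∘ Adj⇒≢ a₂ₓ ∘ sym)
      (⊥-elim ∘ x≢v₃)
      (⊥-elim ∘ Adj∧¬Adj⇒≢ a₂ₓ ¬a₂₄)
      init
    black₄ : B v₄
    black₄ = force black₃ a₃₄ λ x a₃ₓ x≢v₄ → allBut₄-elim x
      (λ { refl → black₁ })
      (λ { refl → black₂ })
      (⊥-elim ∘ Adj⇒≢ a₃ₓ ∘ sym)
      (⊥-elim ∘ x≢v₄)
      init
    forces : IsZeroForcingSet G (allBut₄ v₁ v₂ v₃ v₄)
    forces x = allBut₄-elim x
      (λ { refl → black₁ }) (λ { refl → black₂ }) (λ { refl → black₃ }) (λ { refl → black₄ }) init

  ¬doubleStar : ∀ {a b a₁ a₂ b₁ b₂} → Adj G a b →
    Adj G a a₁ → Adj G a a₂ → a₁ ≢ a₂ → a₁ ≢ b → a₂ ≢ b →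
    Adj G b b₁ → Adj G b b₂ → b₁ ≢ b₂ → b₁ ≢ a → b₂ ≢ a → ⊥
  ¬doubleStar {a} {b} {a₁} {a₂} {b₁} {b₂} ab aa₁ aa₂ a₁≢a₂ a₁≢b a₂≢b bb₁ bb₂ b₁≢b₂ b₁≢a b₂≢a =
    ¬forcing-allBut₄ (Adj⇒≢ aa₂) (Adj⇒≢ ab) (≢-sym b₂≢a) a₂≢b a₂≢b₂ (Adj⇒≢ bb₂) forces
    where
    a₂≢b₂ : a₂ ≢ b₂
    a₂≢b₂ refl = ¬triangle ab bb₂ (Adj-sym aa₂)
    a₁≢b₂ : a₁ ≢ b₂
    a₁≢b₂ refl = ¬triangle ab bb₂ (Adj-sym aa₁)
    b₁≢a₂ : b₁ ≢ a₂
    b₁≢a₂ refl = ¬triangle ab bb₁ (Adj-sym aa₂)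

    B : Fin n → Set
    B = Black G (allBut₄ a a₂ b b₂)
    black-a₁ : B a₁
    black-a₁ = init (∈allBut₄ (≢-sym (Adj⇒≢ aa₁)) a₁≢a₂ a₁≢b a₁≢b₂)
    black-b₁ : B b₁
    black-b₁ = init (∈allBut₄ b₁≢a b₁≢a₂ (≢-sym (Adj⇒≢ bb₁)) b₁≢b₂)
    black-a : B a
    black-a = force black-a₁ (Adj-sym aa₁) λ x a₁x x≢a → allBut₄-elim x
      (⊥-elim ∘ x≢a)
      (λ { refl → ⊥-elim (¬triangle aa₁ a₁x (Adj-sym aa₂)) })
      (λ { refl → ⊥-elim (¬triangle aa₁ a₁x (Adj-sym ab)) })
      (λ { refl → ⊥-elim (¬square aa₁ a₁x (Adj-sym bb₂) (Adj-sym ab) (≢-sym b₂≢a) a₁≢b) })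
      init
    black-b : B b
    black-b = force black-b₁ (Adj-sym bb₁) λ x b₁x x≢b → allBut₄-elim x
      (λ { refl → ⊥-elim (¬triangle bb₁ b₁x ab) })
      (λ { refl → ⊥-elim (¬square bb₁ b₁x (Adj-sym aa₂) ab (≢-sym a₂≢b) b₁≢a) })
      (⊥-elim ∘ x≢b)
      (λ { refl → ⊥-elim (¬triangle bb₁ b₁x (Adj-sym bb₂)) })
      init
    black-a₂ : B a₂
    black-a₂ = force black-a aa₂ λ x ax x≢a₂ → allBut₄-elim x
      (⊥-elim ∘ Adj⇒≢ ax ∘ sym)
      (⊥-elim ∘ x≢a₂)
      (λ { refl → black-b })
      (λ { refl → ⊥-elim (¬triangle ab bb₂ (Adj-sym ax)) })
      init
    black-b₂ : B b₂
    black-b₂ = force black-b bb₂ λ x bx x≢b₂ → allBut₄-elim x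
      (λ { refl → black-a })
      (λ { refl → ⊥-elim (¬triangle ab bx (Adj-sym aa₂)) })
      (⊥-elim ∘ Adj⇒≢ bx ∘ sym)
      (⊥-elim ∘ x≢b₂)
      init
    forces : IsZeroForcingSet G (allBut₄ a a₂ b b₂)
    forces x = allBut₄-elim x
      (λ { refl → black-a }) (λ { refl → black-a₂ }) (λ { refl → black-b }) (λ { refl → black-b₂ }) init

  degree₂-path₄ : ∀ {a b c d} → Path₄ G a b c d →
    ∃ λ a′ → ∃ λ b′ → ∃ λ c′ → ∃ λ d′ → Path₄ G a′ b′ c′ d′ × (∀ {z} → Adj G c′ z → z ≡ b′ ⊎ z ≡ d′)
  degree₂-path₄ {a} {b} {c} {d} p@(ab , bc , cd , a≢c , b≢d) with thirdNeighbour? c b d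
  ... | inj₂ c-nbrs = a , b , c , d , p , c-nbrs
  ... | inj₁ (z , cz , z≢b , z≢d) with thirdNeighbour? b c a
  ...   | inj₂ b-nbrs = d , c , b , a , Path₄-reverse {G = G} p , b-nbrs
  ...   | inj₁ (y , by , y≢c , y≢a) =
          ⊥-elim (¬doubleStar bc (Adj-sym ab) by (≢-sym y≢a) a≢c y≢c cd cz (≢-sym z≢d) (≢-sym b≢d) z≢b)

module DegreeTwoPath {n : ℕ} (G : Graph n) (connected : Connected G)
  (¬path₅ : ∀ {v₀ v₁ v₂ v₃ v₄} → ¬ Path₅ G v₀ v₁ v₂ v₃ v₄)
  {a b c d} (ab : Adj G a b) (bc : Adj G b c) (cd : Adj G c d) (a≢c : a ≢ c) (b≢d : b ≢ d)
  (c-nbrs : ∀ {z} → Adj G c z → z ≡ b ⊎ z ≡ d) where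
  open Adjacency G

  d-leaf : LeafOf d c
  d-leaf {y} dy = decidable-stable (y ≟ c) λ y≢c →
    ¬path₅ (Adj-sym dy , Adj-sym cd , Adj-sym bc , Adj-sym ab , y≢c , ≢-sym b≢d , ≢-sym a≢c)

  spoke-leaf : ∀ {u} → Adj G u b → u ≢ c → LeafOf u b
  spoke-leaf ub u≢c {z} uz = decidable-stable (z ≟ b) λ z≢b →
    ¬path₅ (Adj-sym uz , ub , bc , cd , z≢b , u≢c , b≢d)

  Role : Fin n → Set
  Role u = u ≡ b ⊎ u ≡ c ⊎ u ≡ d ⊎ Adj G u b

  role : ∀ u → Role u
  role = closed⇒everywhere connected Role closed (inj₁ refl)
    where
    next-to-c : ∀ {y} → Adj G y c → Role y
    next-to-c yc with c-nbrs (Adj-sym yc)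
    ... | inj₁ y≡b = inj₁ y≡b
    ... | inj₂ y≡d = inj₂ (inj₂ (inj₁ y≡d))
    closed : ∀ {x y} → Role x → Adj G y x → Role y
    closed (inj₁ refl)                 yb = inj₂ (inj₂ (inj₂ yb))
    closed (inj₂ (inj₁ refl))          yc = next-to-c yc
    closed (inj₂ (inj₂ (inj₁ refl)))   yd = inj₂ (inj₁ (d-leaf (Adj-sym yd)))
    closed {x} (inj₂ (inj₂ (inj₂ xb))) yx with x ≟ c
    ... | yes refl = next-to-c yx
    ... | no x≢c   = inj₁ (spoke-leaf xb x≢c (Adj-sym yx))

module _ {n : ℕ} where

  Permutation-injective : (π : Permutation n n) → ∀ {x y} → π ⟨$⟩ʳ x ≡ π ⟨$⟩ʳ y → x ≡ y
  Permutation-injective π = Injection.injective (↔⇒↣ π)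

  transpose-moves : ∀ (i j : Fin n) → PC.transpose i j i ≡ j
  transpose-moves i j rewrite dec-true (i ≟ i) refl = refl

  transpose-fixes : ∀ (i j k : Fin n) → k ≢ i → k ≢ j → PC.transpose i j k ≡ k
  transpose-fixes i j k k≢i k≢j rewrite dec-false (k ≟ i) k≢i | dec-false (k ≟ j) k≢j = refl

  retarget : (π : Permutation n n) (x i : Fin n) → Σ (Permutation n n) λ ρ →
    ρ ⟨$⟩ʳ x ≡ i × (∀ {y} → y ≢ x → π ⟨$⟩ʳ y ≢ i → ρ ⟨$⟩ʳ y ≡ π ⟨$⟩ʳ y)
  retarget π x i = π ∘ₚ Permutation.transpose (π ⟨$⟩ʳ x) i ,
    transpose-moves (π ⟨$⟩ʳ x) i ,
    λ {y} y≢x πy≢i → transpose-fixes (π ⟨$⟩ʳ x) i (π ⟨$⟩ʳ y) (y≢x ∘ Permutation-injective π) πy≢i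

toFront₃ : ∀ {m} {x y z : Fin (3 + m)} → x ≢ y → x ≢ z → y ≢ z →
  Σ (Permutation (3 + m) (3 + m)) λ π → π ⟨$⟩ʳ x ≡ 0F × π ⟨$⟩ʳ y ≡ 1F × π ⟨$⟩ʳ z ≡ 2F
toFront₃ {x = x} {y} {z} x≢y x≢z y≢z with retarget Permutation.id x 0F
... | π₁ , π₁x , _ with retarget π₁ y 1F
...   | π₂ , π₂y , π₂-fixes with retarget π₂ z 2F
...     | π₃ , π₃z , π₃-fixes = π₃ , π₃x , π₃y , π₃z
  where
  π₂x : π₂ ⟨$⟩ʳ x ≡ 0F
  π₂x = trans (π₂-fixes x≢y (subst (_≢ 1F) (sym π₁x) λ ())) π₁x
  π₃x : π₃ ⟨$⟩ʳ x ≡ 0F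
  π₃x = trans (π₃-fixes x≢z (subst (_≢ 2F) (sym π₂x) λ ())) π₂x
  π₃y : π₃ ⟨$⟩ʳ y ≡ 1F
  π₃y = trans (π₃-fixes y≢z (subst (_≢ 2F) (sym π₂y) λ ())) π₂y

module SubdividedStarShape {m : ℕ} (G : Graph (3 + m)) {b c d : Fin (3 + m)}
  (bc : Adj G b c) (cd : Adj G c d) (b≢d : b ≢ d)
  (c-nbrs : ∀ {z} → Adj G c z → z ≡ b ⊎ z ≡ d)
  (d-leaf : Adjacency.LeafOf G d c)
  (spoke-leaf : ∀ {u} → Adj G u b → u ≢ c → Adjacency.LeafOf G u b)
  (role : ∀ u → u ≡ b ⊎ u ≡ c ⊎ u ≡ d ⊎ Adj G u b) where
  open Adjacency G

  front : Σ (Permutation (3 + m) (3 + m)) λ π → π ⟨$⟩ʳ b ≡ 0F × π ⟨$⟩ʳ c ≡ 1F × π ⟨$⟩ʳ d ≡ 2F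
  front = toFront₃ (Adj⇒≢ bc) b≢d (Adj⇒≢ cd)

  π : Permutation (3 + m) (3 + m)
  π = proj₁ front

  πb : π ⟨$⟩ʳ b ≡ 0F
  πb = proj₁ (proj₂ front)

  πc : π ⟨$⟩ʳ c ≡ 1F
  πc = proj₁ (proj₂ (proj₂ front))

  πd : π ⟨$⟩ʳ d ≡ 2F
  πd = proj₂ (proj₂ (proj₂ front))

  data View : Fin (3 + m) → Set where
    centre : View b
    middle : View c
    end    : View d
    spoke  : ∀ {u} k → π ⟨$⟩ʳ u ≡ suc (suc (suc k)) → Adj G u b → u ≢ c → u ≢ d → View u

  view : ∀ u → View u
  view u with role u
  ... | inj₁ refl                 = centre
  ... | inj₂ (inj₁ refl)          = middle
  ... | inj₂ (inj₂ (inj₁ refl))   = end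
  ... | inj₂ (inj₂ (inj₂ ub)) with u ≟ c | u ≟ d
  ...   | yes refl | _        = middle
  ...   | no _     | yes refl = end
  ...   | no u≢c   | no u≢d with π ⟨$⟩ʳ u in πu
  ...     | 0F                = ⊥-elim (Adj⇒≢ ub (Permutation-injective π (trans πu (sym πb))))
  ...     | 1F                = ⊥-elim (u≢c (Permutation-injective π (trans πu (sym πc))))
  ...     | 2F                = ⊥-elim (u≢d (Permutation-injective π (trans πu (sym πd))))
  ...     | suc (suc (suc k)) = spoke k πu ub u≢c u≢d

  ¬Adj-d-b : ¬ Adj G d b
  ¬Adj-d-b db = Adj⇒≢ bc (d-leaf db)

  ¬Adj-c-spoke : ∀ {u} → Adj G u b → u ≢ d → ¬ Adj G c u
  ¬Adj-c-spoke ub u≢d cu with c-nbrs cu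
  ... | inj₁ refl = Adj-irrefl ub
  ... | inj₂ u≡d  = u≢d u≡d

  edge : ∀ {x y} → Adj G x y → true ≡ adj G x y
  edge = sym

  no-edge : ∀ {x y} → ¬ Adj G x y → false ≡ adj G x y
  no-edge = sym ∘ ¬Adj⇒adj≡false

  no-loop : ∀ x → false ≡ adj G x x
  no-loop x = sym (irrefl G x)

  ≅SubdividedStar : G ≅ SubdividedStar (3 + m)
  ≅SubdividedStar = π , preserves
    where
    preserves : ∀ u v → adj (SubdividedStar (3 + m)) (π ⟨$⟩ʳ u) (π ⟨$⟩ʳ v) ≡ adj G u v
    preserves u v with view u | view v
    ... | centre | centre rewrite πb = no-loop b
    ... | centre | middle rewrite πb | πc = edge bc
    ... | centre | end    rewrite πb | πd = no-edge (¬Adj-d-b ∘ Adj-sym)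
    ... | centre | spoke k πv vb _ _ rewrite πb | πv = edge (Adj-sym vb)
    ... | middle | centre rewrite πb | πc = edge (Adj-sym bc)
    ... | middle | middle rewrite πc = no-loop c
    ... | middle | end    rewrite πc | πd = edge cd
    ... | middle | spoke k πv vb _ v≢d rewrite πc | πv = no-edge (¬Adj-c-spoke vb v≢d)
    ... | end    | centre rewrite πb | πd = no-edge ¬Adj-d-b
    ... | end    | middle rewrite πc | πd = edge (Adj-sym cd)
    ... | end    | end    rewrite πd = no-loop d
    ... | end    | spoke k πv _ v≢c _ rewrite πd | πv = no-edge (v≢c ∘ d-leaf)
    ... | spoke k πu ub _ _ | centre rewrite πb | πu = edge ub
    ... | spoke k πu ub _ u≢d | middle rewrite πc | πu = no-edge (¬Adj-c-spoke ub u≢d ∘ Adj-sym)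
    ... | spoke k πu _ u≢c _ | end rewrite πd | πu = no-edge (u≢c ∘ d-leaf ∘ Adj-sym)
    ... | spoke k πu ub u≢c _ | spoke k′ πv vb _ _ rewrite πu | πv =
      no-edge (Adj⇒≢ vb ∘ spoke-leaf ub u≢c)

theorem4p5 : (n : ℕ) → 5 ≤ n → (G : Graph n) → IsTree G →
    ZeroForcingNumber G (n ∸ 3) → G ≅ SubdividedStar n
theorem4p5 (suc (suc (suc m))) (s≤s (s≤s (s≤s _))) G (connected , acyclic)
           ((S , forces , ∣S∣≡m) , minimal) with Path₄? G
... | no ¬path₄ = ⊥-elim (1+n≰n (subst (3 + m ≤_) (cong (2 +_) ∣S∣≡m) n≤2+∣S∣))
  where
  n≤2+∣S∣ : 3 + m ≤ 2 + ∣ S ∣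
  n≤2+∣S∣ = Path₄Free.n≤2+Z G connected (λ p → ¬path₄ (_ , _ , _ , _ , p)) {0F} {1F} (λ ()) S forces
... | yes (_ , _ , _ , _ , path) with LargeForcingNumber.degree₂-path₄ acyclic minimal path
...   | a , b , c , d , (ab , bc , cd , a≢c , b≢d) , c-nbrs =
  SubdividedStarShape.≅SubdividedStar G bc cd b≢d c-nbrs d-leaf spoke-leaf role
  where
  open DegreeTwoPath G connected (LargeForcingNumber.¬path₅ acyclic minimal) ab bc cd a≢c b≢d c-nbrs
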